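{- Let $G=(I\cup C,E)$ and the word $w$ be as in the context. For all $a,b\in I\cup C$, if $a$ and $b$ are adjacent in $G$, then $a$ and $b$ alternate in $w$.
   Context: For a word $w$ and letters $a,b$, $w|_{\{a,b\}}$ is the subsequence of $w$ of all occurrences of $a,b$; $a,b$ alternate in $w$ if $w|_{\{a,b\}}$ is $abab\cdots$ or $baba\cdots$ (any length). Let $G=(I\cup C,E)$ be a split graph, $I$ independent, $C$ a clique, with $C$ inclusion-wise maximal (no vertex of $I$ is adjacent to all of $C$). For integers $x\le y$ write $[x,y]=\{x,\dots,y\}$. Assume the vertices of $C$ are labelled $1,\dots,k$ ($k=|C|$) so that for all $a,b\in I$: (i) either $N(a)=[1,m]\cup[n,k]$ for some $m<n$, or $N(a)=[l,r]$ for some $l\le r$; (ii) if $N(a)=[1,m]\cup[n,k]$ ($m<n$) and $N(b)=[l,r]$ ($l\le r$) then $l>m$ or $r<n$; (iii) if $N(a)=[1,m]\cup[n,k]$ and $N(b)=[1,m']\cup[n',k]$ ($m<n$, $m'<n'$) then $m'<n$ and $m<n'$. Let $A$ be the set of $a\in I$ whose neighbourhood is of the form $[1,m]\cup[n,k]$ with $1\le m$, $m+1<n\le k$ (not an interval), and $B$ the set of $a\in I$ with $N(a)$ an interval $[l,r]$; $I=A\cup B$ disjointly. Construction: initialise $p_1=p_2=p_3=12\cdots k$ and $d=1$. For each $a\in I$ in turn: if $a\in A$ with $N(a)=[1,m]\cup[n,k]$, set $d:=m$ if $m>d$, insert $a$ immediately after the letter $m$ in $p_1$ and immediately before the letter $n$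 in $p_2$; if $a\in B$ with $N(a)=[l,r]$, insert $a$ immediately before $l$ in $p_1$ and immediately after $r$ in $p_2$. Then replace the letter $d$ in $p_3$ by $d\,(p_1|_A)^R$ ($p_1|_A$ the subsequence of $p_1$ of letters in $A$, $^R$ reversal). Set $w=p_1\,(p_1|_B)^R\,p_2\,p_3$, a 3-uniform word over $I\cup C$. -}

module Defs where

open import Data.Nat using (ℕ; zero; suc; _≤_; _<_; _⊔_; _≡ᵇ_)
open import Data.Fin using (Fin)
open import Data.Fin.Properties using () renaming (_≟_ to _≟F_)
open import Data.Bool using (Bool; true; false; if_then_else_; _∨_; _∧_)
open import Data.List using (List; []; _∷_; _++_; map; upTo; filterᵇ; reverse; concatMap; foldl; length)
open import Data.List.Base using () renaming (allFin to allFinL)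
open import Data.Product using (_×_; _,_)
open import Data.Sum using (_⊎_)
open import Data.Empty using (⊥)
open import Relation.Nullary using (¬_; does)
open import Relation.Binary.PropositionalEquality using (_≡_; _≢_)

-- Letters of the word: clique vertices carry their label (a natural number,
-- valid labels are 1..k); independent vertices are elements of Fin t, and the
-- order of Fin t is the order "for each a ∈ I in turn".
data Letter (t : ℕ) : Set where
  cl : ℕ → Letter t
  iv : Fin t → Letter t

_==_ : {t : ℕ} → Letter t → Letter t → Bool
cl i == cl j = i ≡ᵇ j
iv a == iv b = does (a ≟F b)
_ == _ = false

-- Description of the neighbourhood of a vertex of I:
--   cyc m n  means  N(a) = [1,m] ∪ [n,k]
--   ivl l r  means  N(a) = [l,r]
data Nbhd : Set where
  cyc : ℕ → ℕ → Nbhd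
  ivl : ℕ → ℕ → Nbhd

_∈[_,_] : ℕ → ℕ → ℕ → Set
c ∈[ x , y ] = x ≤ c × c ≤ y

Mem : ℕ → Nbhd → ℕ → Set
Mem k (cyc m n) c = c ∈[ 1 , m ] ⊎ c ∈[ n , k ]
Mem k (ivl l r) c = c ∈[ l , r ]

-- Well-formedness of a description: a ∈ A (1 ≤ m, m+1 < n ≤ k) or a ∈ B (1 ≤ l ≤ r ≤ k)
WF : ℕ → Nbhd → Set
WF k (cyc m n) = 1 ≤ m × suc m < n × n ≤ k
WF k (ivl l r) = 1 ≤ l × l ≤ r × r ≤ k

Adj : (k t : ℕ) → (Fin t → Nbhd) → Letter t → Letter t → Set
Adj k t D (cl i) (cl j) = i ∈[ 1 , k ] × j ∈[ 1 , k ] × i ≢ j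
Adj k t D (cl i) (iv a) = Mem k (D a) i
Adj k t D (iv a) (cl i) = Mem k (D a) i
Adj k t D (iv a) (iv b) = ⊥

insertAfter : {t : ℕ} → Letter t → Letter t → List (Letter t) → List (Letter t)
insertAfter x y [] = []
insertAfter x y (z ∷ zs) = if z == x then z ∷ y ∷ zs else z ∷ insertAfter x y zs

insertBefore : {t : ℕ} → Letter t → Letter t → List (Letter t) → List (Letter t)
insertBefore x y [] = []
insertBefore x y (z ∷ zs) = if z == x then y ∷ z ∷ zs else z ∷ insertBefore x y zs

clique : {t : ℕ} → ℕ → List (Letter t)
clique k = map (λ i → cl (suc i)) (upTo k)

record State (t : ℕ) : Set where
  constructor st
  field
    p₁ : List (Letter t)
    p₂ : List (Letter t)
    d  : ℕ

step : {t : ℕ} → (Fin t → Nbhd) → State t → Fin t → State t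
step D (st p₁ p₂ d) a with D a
... | cyc m n = st (insertAfter (cl m) (iv a) p₁) (insertBefore (cl n) (iv a) p₂) (d ⊔ m)
... | ivl l r = st (insertBefore (cl l) (iv a) p₁) (insertAfter (cl r) (iv a) p₂) d

final : (k t : ℕ) → (Fin t → Nbhd) → State t
final k t D = foldl (step D) (st (clique k) (clique k) 1) (allFinL t)

isA : {t : ℕ} → (Fin t → Nbhd) → Letter t → Bool
isA D (cl _) = false
isA D (iv a) with D a
... | cyc _ _ = true
... | ivl _ _ = false

isB : {t : ℕ} → (Fin t → Nbhd) → Letter t → Bool
isB D (cl _) = false
isB D (iv a) with D a
... | cyc _ _ = false
... | ivl _ _ = true

replaceBy : {t : ℕ} → Letter t → List (Letter t) → List (Letter t) → List (Letter t)
replaceBy x v u = concatMap (λ z → if z == x then v else z ∷ []) u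

word : (k t : ℕ) → (Fin t → Nbhd) → List (Letter t)
word k t D =
  let open State (final k t D)
      p₃ = replaceBy (cl d) (cl d ∷ reverse (filterᵇ (isA D) p₁)) (clique k)
  in p₁ ++ reverse (filterᵇ (isB D) p₁) ++ p₂ ++ p₃

restrict : {t : ℕ} → Letter t → Letter t → List (Letter t) → List (Letter t)
restrict a b = filterᵇ (λ z → (z == a) ∨ (z == b))

altWord : {t : ℕ} → Letter t → Letter t → ℕ → List (Letter t)
altWord a b zero = []
altWord a b (suc n) = a ∷ altWord b a n

Alternate : {t : ℕ} → Letter t → Letter t → List (Letter t) → Set
Alternate a b w =
  let u = restrict a b w in u ≡ altWord a b (length u) ⊎ u ≡ altWord b a (length u)

-- Restricting to a set of letters commutes with the construction. A step that inserts a
-- letter outside the set leaves the restrictions of p₁ and p₂ unchanged, and a step that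
-- inserts a letter of a set containing every clique letter commutes with restricting to it.
-- So, restricted to the clique and one vertex a, the final p₁ and p₂ are 1⋯k with a inserted
-- alone: in p₁ right after m (resp. before l), in p₂ right before n (resp. after r). The
-- restriction of w to two adjacent letters is then read off piece by piece: two clique
-- letters c < c′ occur as c c′ in p₁, p₂ and p₃; for c ∈ N(a) with a ∈ A the order of c and
-- a is the same in p₁, p₂ and p₃, because d is the largest m over A, so m ≤ d < n by (iii);
-- for a ∈ B the extra copy of a in (p₁|_B)^R makes up for a ∉ p₃.
module Submission where

open import Defs
open import Data.Nat using (ℕ; zero; suc; pred; _+_; _∸_; _⊔_; _≤_; _<_; _≡ᵇ_; z≤n; s≤s)
open import Data.Nat.Properties
open import Data.Fin using (Fin)
open import Data.Fin.Properties using () renaming (_≟_ to _≟F_)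
open import Data.Bool using (Bool; true; false; _∨_; T?)
open import Data.Bool.Properties using (∨-comm; ∨-identityʳ)
open import Data.List using (List; []; _∷_; _++_; applyUpTo; filterᵇ; reverse; foldl; length; allFin)
open import Data.List.Properties using (++-identityʳ; unfold-reverse; filter-++; map-applyUpTo; foldl-++)
open import Data.List.Relation.Unary.All as All using (All; []; _∷_)
import Data.List.Relation.Unary.All.Properties as All
open import Data.List.Relation.Unary.AllPairs using (_∷_)
open import Data.List.Relation.Unary.Unique.Propositional using (Unique)
open import Data.List.Relation.Unary.Unique.Propositional.Properties using (allFin⁺)
open import Data.List.Membership.Propositional.Properties using (∈-∃++; ∈-allFin)
open import Data.Product using (_×_; _,_; proj₁; proj₂; ∃₂)
open import Data.Sum using (_⊎_; inj₁; inj₂; swap)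
open import Function using (_∘_)
open import Relation.Nullary using (¬_; does; yes; no; contradiction)
open import Relation.Nullary.Decidable using (dec-true; dec-false)
import Relation.Nullary.Decidable as Dec
open import Relation.Binary.Definitions using (DecidableEquality; tri<; tri≈; tri>)
open import Relation.Binary.PropositionalEquality

open State

≡ᵇ-≢ : ∀ {i j} → i ≢ j → (i ≡ᵇ j) ≡ false
≡ᵇ-≢ i≢j = dec-false (_ ≟ _) i≢j

module _ {t : ℕ} where

  cl-injective : ∀ {i j} → cl {t} i ≡ cl j → i ≡ j
  cl-injective refl = refl

  iv-injective : ∀ {a b} → iv {t} a ≡ iv b → a ≡ b
  iv-injective refl = refl

  _≟ₗ_ : DecidableEquality (Letter t)
  cl i ≟ₗ cl j = Dec.map′ (cong cl) cl-injective (i ≟ j)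
  iv a ≟ₗ iv b = Dec.map′ (cong iv) iv-injective (a ≟F b)
  cl _ ≟ₗ iv _ = no λ ()
  iv _ ≟ₗ cl _ = no λ ()

  ==-does : ∀ x y → (x == y) ≡ does (x ≟ₗ y)
  ==-does (cl _) (cl _) = refl
  ==-does (iv _) (iv _) = refl
  ==-does (cl _) (iv _) = refl
  ==-does (iv _) (cl _) = refl

  ==-refl : ∀ x → (x == x) ≡ true
  ==-refl x = trans (==-does x x) (dec-true (x ≟ₗ x) refl)

  ==-≢ : ∀ {x y} → x ≢ y → (x == y) ≡ false
  ==-≢ {x} {y} x≢y = trans (==-does x y) (dec-false (x ≟ₗ y) x≢y)

  ==⇒≡ : ∀ {x y} → (x == y) ≡ true → x ≡ y
  ==⇒≡ {x} {y} x==y with x ≟ₗ y | ==-does x y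
  ... | yes x≡y | _          = x≡y
  ... | no _    | x==y≡false = contradiction (trans (sym x==y) x==y≡false) λ ()

  cl-<⇒≢ : ∀ {i j} → i < j → cl {t} i ≢ cl j
  cl-<⇒≢ i<j = <⇒≢ i<j ∘ cl-injective

isEither : ∀ {t} → Letter t → Letter t → Letter t → Bool
isEither x y z = (z == x) ∨ (z == y)

isClique : ∀ {t} → Letter t → Bool
isClique (cl _) = true
isClique (iv _) = false

cliqueAnd : ∀ {t} → Fin t → Letter t → Bool
cliqueAnd a z = isClique z ∨ (z == iv a)

module _ {A : Set} where

  filterᵇ-accept : ∀ (p : A → Bool) {x} xs → p x ≡ true → filterᵇ p (x ∷ xs) ≡ x ∷ filterᵇ p xs
  filterᵇ-accept p {x} xs px with p x
  ... | true = refl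

  filterᵇ-reject : ∀ (p : A → Bool) {x} xs → p x ≡ false → filterᵇ p (x ∷ xs) ≡ filterᵇ p xs
  filterᵇ-reject p {x} xs px with p x
  ... | false = refl

  filterᵇ-++ : ∀ (p : A → Bool) xs ys → filterᵇ p (xs ++ ys) ≡ filterᵇ p xs ++ filterᵇ p ys
  filterᵇ-++ p = filter-++ (T? ∘ p)

  filterᵇ-none : ∀ (p : A → Bool) {xs} → All (λ x → p x ≡ false) xs → filterᵇ p xs ≡ []
  filterᵇ-none p []               = refl
  filterᵇ-none p (px≡false ∷ pxs) = trans (filterᵇ-reject p _ px≡false) (filterᵇ-none p pxs)

  filterᵇ-cong : ∀ (p q : A → Bool) {xs} → All (λ x → p x ≡ q x) xs → filterᵇ p xs ≡ filterᵇ q xs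
  filterᵇ-cong p q [] = refl
  filterᵇ-cong p q {x ∷ xs} (px≡qx ∷ pxs≡qxs) with p x | q x
  ... | true  | true  = cong (x ∷_) (filterᵇ-cong p q pxs≡qxs)
  ... | false | false = filterᵇ-cong p q pxs≡qxs

  filterᵇ-reverse : ∀ (p : A → Bool) xs → filterᵇ p (reverse xs) ≡ reverse (filterᵇ p xs)
  filterᵇ-reverse p [] = refl
  filterᵇ-reverse p (x ∷ xs) = begin
    filterᵇ p (reverse (x ∷ xs))  ≡⟨ cong (filterᵇ p) (unfold-reverse x xs) ⟩
    filterᵇ p (reverse xs ++ [x]) ≡⟨ filterᵇ-++ p (reverse xs) _ ⟩
    P (reverse xs) ++ P [x]       ≡⟨ cong (_++ P [x]) (filterᵇ-reverse p xs) ⟩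
    reverse (P xs) ++ P [x]       ≡⟨ snoc (p x) refl ⟩
    reverse (P (x ∷ xs))          ∎
    where
    open ≡-Reasoning
    P : List A → List A
    P = filterᵇ p
    [x] : List A
    [x] = x ∷ []
    snoc : ∀ b → p x ≡ b → reverse (P xs) ++ P [x] ≡ reverse (P (x ∷ xs))
    snoc true  px = trans (cong (reverse (P xs) ++_) (filterᵇ-accept p [] px))
                      (trans (sym (unfold-reverse x (P xs))) (cong reverse (sym (filterᵇ-accept p xs px))))
    snoc false px = trans (cong (reverse (P xs) ++_) (filterᵇ-reject p [] px))
                      (trans (++-identityʳ _) (cong reverse (sym (filterᵇ-reject p xs px))))

  filterᵇ-comm : ∀ (p q : A → Bool) xs → filterᵇ p (filterᵇ q xs) ≡ filterᵇ q (filterᵇ p xs)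
  filterᵇ-comm p q [] = refl
  filterᵇ-comm p q (x ∷ xs) with q x in qx | p x in px
  ... | true  | true  rewrite px | qx = cong (x ∷_) (filterᵇ-comm p q xs)
  ... | true  | false rewrite px      = filterᵇ-comm p q xs
  ... | false | true  rewrite qx      = filterᵇ-comm p q xs
  ... | false | false                 = filterᵇ-comm p q xs

  filterᵇ-absorb : ∀ (p q : A → Bool) → (∀ x → q x ≡ true → p x ≡ true) →
                   ∀ xs → filterᵇ q (filterᵇ p xs) ≡ filterᵇ q xs
  filterᵇ-absorb p q q⇒p [] = refl
  filterᵇ-absorb p q q⇒p (x ∷ xs) with p x in px | q x in qx
  ... | true  | true  rewrite qx = cong (x ∷_) (filterᵇ-absorb p q q⇒p xs)
  ... | true  | false rewrite qx = filterᵇ-absorb p q q⇒p xs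
  ... | false | true  = contradiction (trans (sym (q⇒p x qx)) px) λ ()
  ... | false | false = filterᵇ-absorb p q q⇒p xs

length-altWord : ∀ {t} (x y : Letter t) n → length (altWord x y n) ≡ n
length-altWord x y zero    = refl
length-altWord x y (suc n) = cong suc (length-altWord y x n)

restrict-comm : ∀ {t} (x y : Letter t) w → restrict y x w ≡ restrict x y w
restrict-comm x y w = filterᵇ-cong _ _ (All.universal (λ z → ∨-comm (z == y) (z == x)) w)

module _ {t : ℕ} {x y : Letter t} (w : List (Letter t)) where

  alternating : ∀ n → restrict x y w ≡ altWord x y n → Alternate x y w
  alternating n e rewrite e = inj₁ (cong (altWord x y) (sym (length-altWord x y n)))

  alternating′ : ∀ n → restrict x y w ≡ altWord y x n → Alternate x y w
  alternating′ n e rewrite e = inj₂ (cong (altWord y x) (sym (length-altWord y x n)))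

  alternate-sym : Alternate x y w → Alternate y x w
  alternate-sym alt rewrite restrict-comm x y w = swap alt

module _ {t : ℕ} {x y : Letter t} where

  insertAfter-here : ∀ zs → insertAfter x y (x ∷ zs) ≡ x ∷ y ∷ zs
  insertAfter-here zs rewrite ==-refl x = refl

  insertAfter-there : ∀ {z} zs → z ≢ x → insertAfter x y (z ∷ zs) ≡ z ∷ insertAfter x y zs
  insertAfter-there {z} zs z≢x rewrite ==-≢ z≢x = refl

  insertBefore-here : ∀ zs → insertBefore x y (x ∷ zs) ≡ y ∷ x ∷ zs
  insertBefore-here zs rewrite ==-refl x = refl

  insertBefore-there : ∀ {z} zs → z ≢ x → insertBefore x y (z ∷ zs) ≡ z ∷ insertBefore x y zs
  insertBefore-there {z} zs z≢x rewrite ==-≢ z≢x = refl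

module _ {t : ℕ} {x : Letter t} {V : List (Letter t)} where

  replaceBy-here : ∀ zs → replaceBy x V (x ∷ zs) ≡ V ++ replaceBy x V zs
  replaceBy-here zs rewrite ==-refl x = refl

  replaceBy-there : ∀ {z} zs → z ≢ x → replaceBy x V (z ∷ zs) ≡ z ∷ replaceBy x V zs
  replaceBy-there {z} zs z≢x rewrite ==-≢ z≢x = refl

  replaceBy-absent : ∀ {zs} → All (_≢ x) zs → replaceBy x V zs ≡ zs
  replaceBy-absent []                                = refl
  replaceBy-absent (z≢x ∷ zs≢x) rewrite ==-≢ z≢x = cong (_ ∷_) (replaceBy-absent zs≢x)

module _ {t : ℕ} (q : Letter t → Bool) {x y : Letter t} where

  filterᵇ-insertAfter-reject : ∀ u → q y ≡ false → filterᵇ q (insertAfter x y u) ≡ filterᵇ q u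
  filterᵇ-insertAfter-reject []       _        = refl
  filterᵇ-insertAfter-reject (z ∷ zs) qy≡false with z == x
  ... | true with q z
  ...   | true  = cong (z ∷_) (filterᵇ-reject q zs qy≡false)
  ...   | false = filterᵇ-reject q zs qy≡false
  filterᵇ-insertAfter-reject (z ∷ zs) qy≡false | false with q z
  ...   | true  = cong (z ∷_) (filterᵇ-insertAfter-reject zs qy≡false)
  ...   | false = filterᵇ-insertAfter-reject zs qy≡false

  filterᵇ-insertBefore-reject : ∀ u → q y ≡ false → filterᵇ q (insertBefore x y u) ≡ filterᵇ q u
  filterᵇ-insertBefore-reject []       _        = refl
  filterᵇ-insertBefore-reject (z ∷ zs) qy≡false with z == x
  ... | true  = filterᵇ-reject q (z ∷ zs) qy≡false
  ... | false with q z
  ...   | true  = cong (z ∷_) (filterᵇ-insertBefore-reject zs qy≡false)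
  ...   | false = filterᵇ-insertBefore-reject zs qy≡false

  filterᵇ-insertAfter-accept : ∀ u → q x ≡ true → q y ≡ true →
                               filterᵇ q (insertAfter x y u) ≡ insertAfter x y (filterᵇ q u)
  filterᵇ-insertAfter-accept []       _  _  = refl
  filterᵇ-insertAfter-accept (z ∷ zs) qx qy with z == x in z==x
  ... | true with refl ← ==⇒≡ {x = z} {y = x} z==x rewrite qx | qy = sym (insertAfter-here (filterᵇ q zs))
  ... | false with q z
  ...   | true  rewrite z==x = cong (z ∷_) (filterᵇ-insertAfter-accept zs qx qy)
  ...   | false = filterᵇ-insertAfter-accept zs qx qy

  filterᵇ-insertBefore-accept : ∀ u → q x ≡ true → q y ≡ true →
                                filterᵇ q (insertBefore x y u) ≡ insertBefore x y (filterᵇ q u)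
  filterᵇ-insertBefore-accept []       _  _  = refl
  filterᵇ-insertBefore-accept (z ∷ zs) qx qy with z == x in z==x
  ... | true with refl ← ==⇒≡ {x = z} {y = x} z==x rewrite qy | qx = sym (insertBefore-here (filterᵇ q zs))
  ... | false with q z
  ...   | true  rewrite z==x = cong (z ∷_) (filterᵇ-insertBefore-accept zs qx qy)
  ...   | false = filterᵇ-insertBefore-accept zs qx qy

-- Segments of the clique word

module _ {t : ℕ} where

  seg : ℕ → ℕ → List (Letter t)
  seg s zero    = []
  seg s (suc n) = cl s ∷ seg (suc s) n

  applyUpTo-seg : ∀ {f : ℕ → Letter t} s n → (∀ i → f i ≡ cl (s + i)) → applyUpTo f n ≡ seg s n
  applyUpTo-seg s zero    _  = refl
  applyUpTo-seg s (suc n) f≗ = cong₂ _∷_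
    (trans (f≗ 0) (cong cl (+-identityʳ s)))
    (applyUpTo-seg (suc s) n λ i → trans (f≗ (suc i)) (cong cl (+-suc s i)))

  clique-seg : ∀ k → clique {t} k ≡ seg 1 k
  clique-seg k = trans (map-applyUpTo _ _ k) (applyUpTo-seg 1 k λ _ → refl)

  seg-++ : ∀ s m n → seg s (m + n) ≡ seg s m ++ seg (s + m) n
  seg-++ s zero    n rewrite +-identityʳ s = refl
  seg-++ s (suc m) n rewrite +-suc s m     = cong (cl s ∷_) (seg-++ (suc s) m n)

  All-seg : ∀ (P : Letter t → Set) s n → (∀ {i} → s ≤ i → i < s + n → P (cl i)) → All P (seg s n)
  All-seg P s zero    _       = []
  All-seg P s (suc n) P-range =
    P-range ≤-refl (m<m+n s (s≤s z≤n)) ∷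
    All-seg P (suc s) n λ {i} s<i i<s+n → P-range (<⇒≤ s<i) (subst (i <_) (sym (+-suc s n)) i<s+n)

  filter-==-seg : ∀ {c} s n → s ≤ c → c < s + n → filterᵇ (_== cl c) (seg s n) ≡ cl c ∷ []
  filter-==-seg {c} s zero    s≤c c<s+0 = contradiction (subst (c <_) (+-identityʳ s) c<s+0) (≤⇒≯ s≤c)
  filter-==-seg {c} s (suc n) s≤c c<s+n with s ≟ c
  ... | yes refl = trans (filterᵇ-accept (_== cl c) (seg (suc s) n) (==-refl {t} (cl c)))
    (cong (cl c ∷_) (filterᵇ-none (_== cl c) (All-seg _ (suc s) n λ s<i _ → ==-≢ {t} (≢-sym (cl-<⇒≢ s<i)))))
  ... | no s≢c = trans (filterᵇ-reject (_== cl c) {cl s} (seg (suc s) n) (==-≢ {t} (s≢c ∘ cl-injective)))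
    (filter-==-seg (suc s) n (≤∧≢⇒< s≤c s≢c) (subst (c <_) (+-suc s n) c<s+n))

  insertAfter-seg : ∀ y s j r →
    insertAfter (cl (s + j)) y (seg s (suc j + r)) ≡ seg s (suc j) ++ y ∷ seg (suc (s + j)) r
  insertAfter-seg y s zero    r rewrite +-identityʳ s = insertAfter-here (seg (suc s) r)
  insertAfter-seg y s (suc j) r rewrite +-suc s j     =
    trans (insertAfter-there {z = cl s} (seg (suc s) (suc j + r)) (cl-<⇒≢ (s≤s (m≤m+n s j))))
      (cong (cl s ∷_) (insertAfter-seg y (suc s) j r))

  insertBefore-seg : ∀ y s j r → 0 < r →
    insertBefore (cl (s + j)) y (seg s (j + r)) ≡ seg s j ++ y ∷ seg (s + j) r
  insertBefore-seg y s zero    (suc r) _ rewrite +-identityʳ s = insertBefore-here (seg (suc s) r)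
  insertBefore-seg y s (suc j) r     0<r rewrite +-suc s j     =
    trans (insertBefore-there {z = cl s} (seg (suc s) (j + r)) (cl-<⇒≢ (s≤s (m≤m+n s j))))
      (cong (cl s ∷_) (insertBefore-seg y (suc s) j r 0<r))

  replaceBy-seg : ∀ V s j r →
    replaceBy (cl (s + j)) (cl (s + j) ∷ V) (seg s (suc j + r)) ≡ seg s (suc j) ++ V ++ seg (suc (s + j)) r
  replaceBy-seg V s zero    r rewrite +-identityʳ s =
    trans (replaceBy-here (seg (suc s) r))
      (cong (λ rest → cl s ∷ V ++ rest) (replaceBy-absent (All-seg _ (suc s) r λ s<i _ → ≢-sym (cl-<⇒≢ s<i))))
  replaceBy-seg V s (suc j) r rewrite +-suc s j     =
    trans (replaceBy-there {z = cl s} (seg (suc s) (suc j + r)) (cl-<⇒≢ (s≤s (m≤m+n s j))))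
      (cong (cl s ∷_) (replaceBy-seg V (suc s) j r))

  cliqueWith : ℕ → ℕ → List (Letter t) → List (Letter t)
  cliqueWith k j M = seg 1 j ++ M ++ seg (suc j) (k ∸ j)

  clique-split : ∀ {j k} → j ≤ k → clique {t} k ≡ seg 1 (j + (k ∸ j))
  clique-split {j} {k} j≤k = trans (clique-seg k) (cong (seg 1) (sym (m+[n∸m]≡n j≤k)))

  clique-cliqueWith : ∀ {j k} → j ≤ k → clique k ≡ cliqueWith k j []
  clique-cliqueWith {j} {k} j≤k = trans (clique-split j≤k) (seg-++ 1 j (k ∸ j))

  insertAfter-clique : ∀ {j k} y → 1 ≤ j → j ≤ k → insertAfter (cl j) y (clique k) ≡ cliqueWith k j (y ∷ [])
  insertAfter-clique {suc j} {k} y _ j<k =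
    trans (cong (insertAfter (cl (suc j)) y) (clique-split j<k)) (insertAfter-seg y 1 j (k ∸ suc j))

  insertBefore-clique : ∀ {j k} y → j < k → insertBefore (cl (suc j)) y (clique k) ≡ cliqueWith k j (y ∷ [])
  insertBefore-clique {j} {k} y j<k =
    trans (cong (insertBefore (cl (suc j)) y) (clique-split (<⇒≤ j<k)))
      (insertBefore-seg y 1 j (k ∸ j) (m<n⇒0<n∸m j<k))

  replaceBy-clique : ∀ {j k} V → 1 ≤ j → j ≤ k → replaceBy (cl j) (cl j ∷ V) (clique k) ≡ cliqueWith k j V
  replaceBy-clique {suc j} {k} V _ j<k =
    trans (cong (replaceBy (cl (suc j)) (cl (suc j) ∷ V)) (clique-split j<k)) (replaceBy-seg V 1 j (k ∸ suc j))

  filterᵇ-cliqueWith : ∀ (q : Letter t → Bool) k j M →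
    filterᵇ q (cliqueWith k j M) ≡ filterᵇ q (seg 1 j) ++ filterᵇ q M ++ filterᵇ q (seg (suc j) (k ∸ j))
  filterᵇ-cliqueWith q k j M =
    trans (filterᵇ-++ q (seg 1 j) _) (cong (filterᵇ q (seg 1 j) ++_) (filterᵇ-++ q M _))

  filterᵇ-cliqueWith-[] : ∀ (q : Letter t → Bool) {j k} M → filterᵇ q M ≡ [] → j ≤ k →
                          filterᵇ q (cliqueWith k j M) ≡ filterᵇ q (clique k)
  filterᵇ-cliqueWith-[] q {j} {k} M qM≡[] j≤k = begin
    Q (cliqueWith k j M)                          ≡⟨ filterᵇ-cliqueWith q k j M ⟩
    Q (seg 1 j) ++ Q M ++ Q (seg (suc j) (k ∸ j)) ≡⟨ cong (λ QM → Q (seg 1 j) ++ QM ++ _) qM≡[] ⟩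
    Q (seg 1 j) ++ [] ++ Q (seg (suc j) (k ∸ j))  ≡⟨ filterᵇ-cliqueWith q k j [] ⟨
    Q (cliqueWith k j [])                         ≡⟨ cong Q (clique-cliqueWith j≤k) ⟨
    Q (clique k)                                  ∎
    where
    open ≡-Reasoning
    Q : List (Letter t) → List (Letter t)
    Q = filterᵇ q

  restrict-clique : ∀ {c c′ k} → 1 ≤ c → c < c′ → c′ ≤ k →
                    restrict (cl c) (cl c′) (clique k) ≡ cl c ∷ cl c′ ∷ []
  restrict-clique {c} {c′} {k} 1≤c c<c′ c′≤k = begin
    R (clique k)
      ≡⟨ cong R (clique-cliqueWith c≤k) ⟩
    R (seg 1 c ++ seg (suc c) (k ∸ c))
      ≡⟨ filterᵇ-++ _ (seg 1 c) _ ⟩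
    R (seg 1 c) ++ R (seg (suc c) (k ∸ c))
      ≡⟨ cong₂ _++_ (filterᵇ-cong _ _ (All-seg _ 1 c lower)) (filterᵇ-cong _ _ (All-seg _ (suc c) (k ∸ c) upper)) ⟩
    filterᵇ (_== cl c) (seg 1 c) ++ filterᵇ (_== cl c′) (seg (suc c) (k ∸ c))
      ≡⟨ cong₂ _++_ (filter-==-seg 1 c 1≤c ≤-refl) (filter-==-seg (suc c) (k ∸ c) c<c′ c′<1+c+[k∸c]) ⟩
    cl c ∷ cl c′ ∷ []
      ∎
    where
    open ≡-Reasoning
    R : List (Letter t) → List (Letter t)
    R = restrict (cl c) (cl c′)
    c≤k : c ≤ k
    c≤k = <⇒≤ (<-≤-trans c<c′ c′≤k)
    c′<1+c+[k∸c] : c′ < suc c + (k ∸ c)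
    c′<1+c+[k∸c] = s≤s (subst (c′ ≤_) (sym (m+[n∸m]≡n c≤k)) c′≤k)
    lower : ∀ {i} → 1 ≤ i → i < 1 + c → ((i ≡ᵇ c) ∨ (i ≡ᵇ c′)) ≡ (i ≡ᵇ c)
    lower _ i≤c rewrite ≡ᵇ-≢ (<⇒≢ (<-≤-trans i≤c c<c′)) = ∨-identityʳ _
    upper : ∀ {i} → suc c ≤ i → i < suc c + (k ∸ c) → ((i ≡ᵇ c) ∨ (i ≡ᵇ c′)) ≡ (i ≡ᵇ c′)
    upper c<i _ rewrite ≡ᵇ-≢ (≢-sym (<⇒≢ c<i)) = refl

module _ {t : ℕ} {c : ℕ} {a : Fin t} where

  private
    R : List (Letter t) → List (Letter t)
    R = restrict (cl c) (iv a)

  restrict-seg-∋ : ∀ s n → s ≤ c → c < s + n → R (seg s n) ≡ cl c ∷ []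
  restrict-seg-∋ s n s≤c c<s+n =
    trans (filterᵇ-cong _ _ (All-seg _ s n λ _ _ → ∨-identityʳ _)) (filter-==-seg s n s≤c c<s+n)

  restrict-seg-∌ : ∀ s n → (∀ {i} → s ≤ i → i < s + n → i ≢ c) → R (seg s n) ≡ []
  restrict-seg-∌ s n ≢c =
    filterᵇ-none _ (All-seg _ s n λ s≤i i<s+n → trans (∨-identityʳ _) (≡ᵇ-≢ (≢c s≤i i<s+n)))

  restrict-cliqueWith-≤ : ∀ {j k} M → 1 ≤ c → c ≤ j → R (cliqueWith k j M) ≡ cl c ∷ R M
  restrict-cliqueWith-≤ {j} {k} M 1≤c c≤j = begin
    R (cliqueWith k j M)                          ≡⟨ filterᵇ-cliqueWith _ k j M ⟩
    R (seg 1 j) ++ R M ++ R (seg (suc j) (k ∸ j)) ≡⟨ cong₂ (λ u v → u ++ R M ++ v) here absent ⟩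
    cl c ∷ R M ++ []                              ≡⟨ cong (cl c ∷_) (++-identityʳ (R M)) ⟩
    cl c ∷ R M                                    ∎
    where
    open ≡-Reasoning
    here : R (seg 1 j) ≡ cl c ∷ []
    here = restrict-seg-∋ 1 j 1≤c (s≤s c≤j)
    absent : R (seg (suc j) (k ∸ j)) ≡ []
    absent = restrict-seg-∌ (suc j) (k ∸ j) λ j<i _ → ≢-sym (<⇒≢ (≤-<-trans c≤j j<i))

  restrict-cliqueWith-> : ∀ {j k} M → j < c → c ≤ k → R (cliqueWith k j M) ≡ R M ++ cl c ∷ []
  restrict-cliqueWith-> {j} {k} M j<c c≤k = begin
    R (cliqueWith k j M)                          ≡⟨ filterᵇ-cliqueWith _ k j M ⟩
    R (seg 1 j) ++ R M ++ R (seg (suc j) (k ∸ j)) ≡⟨ cong₂ (λ u v → u ++ R M ++ v) absent here ⟩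
    R M ++ cl c ∷ []                              ∎
    where
    open ≡-Reasoning
    absent : R (seg 1 j) ≡ []
    absent = restrict-seg-∌ 1 j λ _ i≤j → <⇒≢ (<-≤-trans i≤j j<c)
    here : R (seg (suc j) (k ∸ j)) ≡ cl c ∷ []
    here = restrict-seg-∋ (suc j) (k ∸ j) j<c
      (s≤s (subst (c ≤_) (sym (m+[n∸m]≡n (<⇒≤ (<-≤-trans j<c c≤k)))) c≤k))

  restrict-iv : R (iv a ∷ []) ≡ iv a ∷ []
  restrict-iv = filterᵇ-accept (isEither (cl c) (iv a)) [] (==-refl (iv a))

  restrict-cliqueWith-[a]-≤ : ∀ {j k} → 1 ≤ c → c ≤ j → R (cliqueWith k j (iv a ∷ [])) ≡ cl c ∷ iv a ∷ []
  restrict-cliqueWith-[a]-≤ 1≤c c≤j = trans (restrict-cliqueWith-≤ _ 1≤c c≤j) (cong (cl c ∷_) restrict-iv)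

  restrict-cliqueWith-[a]-> : ∀ {j k} → j < c → c ≤ k → R (cliqueWith k j (iv a ∷ [])) ≡ iv a ∷ cl c ∷ []
  restrict-cliqueWith-[a]-> j<c c≤k = trans (restrict-cliqueWith-> _ j<c c≤k) (cong (_++ cl c ∷ []) restrict-iv)

-- States agreeing on a set of letters

unique-split : ∀ {A : Set} xs {a : A} {ys} → Unique (xs ++ a ∷ ys) → All (_≢ a) xs × All (_≢ a) ys
unique-split []       (a∉ys ∷ _)       = [] , All.map ≢-sym a∉ys
unique-split (x ∷ xs) (x∉xs++a∷ys ∷ u) =
  let xs≢a , ys≢a = unique-split xs u
  in All.head (All.++⁻ʳ xs x∉xs++a∷ys) ∷ xs≢a , ys≢a

allFin-split : ∀ {t} (a : Fin t) → ∃₂ λ xs ys → allFin t ≡ xs ++ a ∷ ys × All (_≢ a) xs × All (_≢ a) ys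
allFin-split {t} a with xs , ys , eq ← ∈-∃++ (∈-allFin a) =
  xs , ys , eq , unique-split xs (subst Unique eq (allFin⁺ t))

record _≈[_]_ {t} (s : State t) (q : Letter t → Bool) (s′ : State t) : Set where
  constructor agree
  field
    on-p₁ : filterᵇ q (p₁ s) ≡ filterᵇ q (p₁ s′)
    on-p₂ : filterᵇ q (p₂ s) ≡ filterᵇ q (p₂ s′)

open _≈[_]_

≈-trans : ∀ {t} {q : Letter t → Bool} {s s′ s″} → s ≈[ q ] s′ → s′ ≈[ q ] s″ → s ≈[ q ] s″
≈-trans (agree e₁ e₂) (agree e₁′ e₂′) = agree (trans e₁ e₁′) (trans e₂ e₂′)

≈-finer : ∀ {t} {q q′ : Letter t → Bool} → (∀ z → q′ z ≡ true → q z ≡ true) →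
          ∀ {s s′} → s ≈[ q ] s′ → s ≈[ q′ ] s′
≈-finer {q = q} {q′} q′⇒q {s} {s′} (agree e₁ e₂) =
  agree (finer (p₁ s) (p₁ s′) e₁) (finer (p₂ s) (p₂ s′) e₂)
  where
  finer : ∀ u u′ → filterᵇ q u ≡ filterᵇ q u′ → filterᵇ q′ u ≡ filterᵇ q′ u′
  finer u u′ e = begin
    filterᵇ q′ u                ≡⟨ filterᵇ-absorb q q′ q′⇒q u ⟨
    filterᵇ q′ (filterᵇ q u)    ≡⟨ cong (filterᵇ q′) e ⟩
    filterᵇ q′ (filterᵇ q u′)   ≡⟨ filterᵇ-absorb q q′ q′⇒q u′ ⟩
    filterᵇ q′ u′               ∎
    where open ≡-Reasoning

module _ {t : ℕ} where

  place₁ place₂ : Nbhd → Letter t → List (Letter t) → List (Letter t)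
  place₁ (cyc m n) = insertAfter (cl m)
  place₁ (ivl l r) = insertBefore (cl l)
  place₂ (cyc m n) = insertBefore (cl n)
  place₂ (ivl l r) = insertAfter (cl r)

  filterᵇ-place₁-reject : ∀ q N {y} u → q y ≡ false → filterᵇ q (place₁ N y u) ≡ filterᵇ q u
  filterᵇ-place₁-reject q (cyc m n) = filterᵇ-insertAfter-reject q
  filterᵇ-place₁-reject q (ivl l r) = filterᵇ-insertBefore-reject q

  filterᵇ-place₂-reject : ∀ q N {y} u → q y ≡ false → filterᵇ q (place₂ N y u) ≡ filterᵇ q u
  filterᵇ-place₂-reject q (cyc m n) = filterᵇ-insertBefore-reject q
  filterᵇ-place₂-reject q (ivl l r) = filterᵇ-insertAfter-reject q

  filterᵇ-place₁-accept : ∀ q N {y} u → (∀ i → q (cl i) ≡ true) → q y ≡ true →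
                          filterᵇ q (place₁ N y u) ≡ place₁ N y (filterᵇ q u)
  filterᵇ-place₁-accept q (cyc m n) u q-cl = filterᵇ-insertAfter-accept q u (q-cl m)
  filterᵇ-place₁-accept q (ivl l r) u q-cl = filterᵇ-insertBefore-accept q u (q-cl l)

  filterᵇ-place₂-accept : ∀ q N {y} u → (∀ i → q (cl i) ≡ true) → q y ≡ true →
                          filterᵇ q (place₂ N y u) ≡ place₂ N y (filterᵇ q u)
  filterᵇ-place₂-accept q (cyc m n) u q-cl = filterᵇ-insertBefore-accept q u (q-cl n)
  filterᵇ-place₂-accept q (ivl l r) u q-cl = filterᵇ-insertAfter-accept q u (q-cl r)

-- inserted alone into 1 ⋯ k, a vertex with neighbourhood N lands right after the clique letter slotᵢ N in pᵢ
slot₁ slot₂ : Nbhd → ℕ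
slot₁ (cyc m n) = m
slot₁ (ivl l r) = pred l
slot₂ (cyc m n) = pred n
slot₂ (ivl l r) = r

cyc-m<n : ∀ {k m n} → WF k (cyc m n) → m < n
cyc-m<n {m = m} (_ , 1+m<n , _) = <-trans (n<1+n m) 1+m<n

cyc-n≤k : ∀ {k m n} → WF k (cyc m n) → n ≤ k
cyc-n≤k (_ , _ , n≤k) = n≤k

module _ {t : ℕ} {k : ℕ} where

  place₁-clique : ∀ {N} (y : Letter t) → WF k N → place₁ N y (clique k) ≡ cliqueWith k (slot₁ N) (y ∷ [])
  place₁-clique {cyc m n}       y wf-N@(1≤m , _) =
    insertAfter-clique y 1≤m (<⇒≤ (<-≤-trans (cyc-m<n wf-N) (cyc-n≤k wf-N)))
  place₁-clique {ivl (suc l) r} y (_ , l<r , r≤k) = insertBefore-clique y (<-≤-trans l<r r≤k)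

  place₂-clique : ∀ {N} (y : Letter t) → WF k N → place₂ N y (clique k) ≡ cliqueWith k (slot₂ N) (y ∷ [])
  place₂-clique {cyc m (suc n)} y (_ , _ , n<k)     = insertBefore-clique y n<k
  place₂-clique {ivl l r}       y (1≤l , l≤r , r≤k) = insertAfter-clique y (≤-trans 1≤l l≤r) r≤k

module Steps {t : ℕ} (D : Fin t → Nbhd) where

  step-p₁ : ∀ s a → p₁ (step D s a) ≡ place₁ (D a) (iv a) (p₁ s)
  step-p₁ s a with D a
  ... | cyc m n = refl
  ... | ivl l r = refl

  step-p₂ : ∀ s a → p₂ (step D s a) ≡ place₂ (D a) (iv a) (p₂ s)
  step-p₂ s a with D a
  ... | cyc m n = refl
  ... | ivl l r = refl

  step-≈-unseen : ∀ q s b → q (iv b) ≡ false → step D s b ≈[ q ] s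
  step-≈-unseen q s b qb≡false = agree
    (trans (cong (filterᵇ q) (step-p₁ s b)) (filterᵇ-place₁-reject q (D b) (p₁ s) qb≡false))
    (trans (cong (filterᵇ q) (step-p₂ s b)) (filterᵇ-place₂-reject q (D b) (p₂ s) qb≡false))

  steps-≈-unseen : ∀ q s bs → All (λ b → q (iv b) ≡ false) bs → foldl (step D) s bs ≈[ q ] s
  steps-≈-unseen q s []       []               = agree refl refl
  steps-≈-unseen q s (b ∷ bs) (qb≡false ∷ qbs) =
    ≈-trans (steps-≈-unseen q (step D s b) bs qbs) (step-≈-unseen q s b qb≡false)

  step-≈-cong : ∀ q a → (∀ i → q (cl i) ≡ true) → q (iv a) ≡ true →
                ∀ {s s′} → s ≈[ q ] s′ → step D s a ≈[ q ] step D s′ a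
  step-≈-cong q a q-cl qa {s} {s′} (agree e₁ e₂) = agree
    (via (place₁ (D a) (iv a)) (step-p₁ s a) (step-p₁ s′ a)
      (λ u → filterᵇ-place₁-accept q (D a) u q-cl qa) e₁)
    (via (place₂ (D a) (iv a)) (step-p₂ s a) (step-p₂ s′ a)
      (λ u → filterᵇ-place₂-accept q (D a) u q-cl qa) e₂)
    where
    via : ∀ (f : List (Letter t) → List (Letter t)) {u u′ v v′} → v ≡ f u → v′ ≡ f u′ →
          (∀ u → filterᵇ q (f u) ≡ f (filterᵇ q u)) →
          filterᵇ q u ≡ filterᵇ q u′ → filterᵇ q v ≡ filterᵇ q v′
    via f {u} {u′} refl refl filter-f e = trans (filter-f u) (trans (cong f e) (sym (filter-f u′)))

  d-invariant : ∀ (P : ℕ → Set) → (∀ {b m n x} → D b ≡ cyc m n → P x → P (x ⊔ m)) →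
                ∀ s bs → P (d s) → P (d (foldl (step D) s bs))
  d-invariant P pres s []       Pd = Pd
  d-invariant P pres s (b ∷ bs) Pd = d-invariant P pres (step D s b) bs (step-d b)
    where
    step-d : ∀ b → P (d (step D s b))
    step-d b with D b in Db
    ... | cyc m n = pres Db Pd
    ... | ivl l r = Pd

  step-d-cyc : ∀ s a {m n} → D a ≡ cyc m n → d (step D s a) ≡ d s ⊔ m
  step-d-cyc s a Da rewrite Da = refl

  isA-cyc : ∀ {a m n} → D a ≡ cyc m n → isA D (iv a) ≡ true
  isA-cyc Da rewrite Da = refl

  isB-cyc : ∀ {a m n} → D a ≡ cyc m n → isB D (iv a) ≡ false
  isB-cyc Da rewrite Da = refl

  isA-ivl : ∀ {a l r} → D a ≡ ivl l r → isA D (iv a) ≡ false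
  isA-ivl Da rewrite Da = refl

  isB-ivl : ∀ {a l r} → D a ≡ ivl l r → isB D (iv a) ≡ true
  isB-ivl Da rewrite Da = refl

CycCompatible : ∀ {t} → (Fin t → Nbhd) → Set
CycCompatible D = ∀ a b m n m′ n′ → D a ≡ cyc m n → D b ≡ cyc m′ n′ → m′ < n × m < n′

-- The final word

module Final {t : ℕ} (k : ℕ) (D : Fin t → Nbhd) (wf : ∀ a → WF k (D a)) where

  open Steps D

  initial : State t
  initial = st (clique k) (clique k) 1

  S : State t
  S = final k t D

  w : List (Letter t)
  w = word k t D

  p₃ : List (Letter t)
  p₃ = replaceBy (cl (d S)) (cl (d S) ∷ reverse (filterᵇ (isA D) (p₁ S))) (clique k)

  final-split : ∀ a → ∃₂ λ xs ys →
    S ≡ foldl (step D) (step D (foldl (step D) initial xs) a) ys × All (_≢ a) xs × All (_≢ a) ys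
  final-split a with xs , ys , eq , xs≢a , ys≢a ← allFin-split a =
    xs , ys , trans (cong (foldl (step D) initial) eq) (foldl-++ (step D) initial xs (a ∷ ys)) , xs≢a , ys≢a

  final-≈-clique : S ≈[ isClique ] initial
  final-≈-clique = steps-≈-unseen isClique initial (allFin t) (All.universal (λ _ → refl) _)

  final-≈-alone : ∀ a → S ≈[ cliqueAnd a ] step D initial a
  final-≈-alone a with xs , ys , S≡ , xs≢a , ys≢a ← final-split a rewrite S≡ =
    ≈-trans (steps-≈-unseen (cliqueAnd a) _ ys (unseen ys≢a))
            (step-≈-cong (cliqueAnd a) a (λ _ → refl) (==-refl (iv a))
              (steps-≈-unseen (cliqueAnd a) initial xs (unseen xs≢a)))
    where
    unseen : ∀ {bs} → All (_≢ a) bs → All (λ b → cliqueAnd a (iv b) ≡ false) bs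
    unseen = All.map λ b≢a → ==-≢ (b≢a ∘ iv-injective)

  final-≈-clique-pair : ∀ c c′ → S ≈[ isEither (cl c) (cl c′) ] initial
  final-≈-clique-pair c c′ = ≈-finer clique-only final-≈-clique
    where
    clique-only : ∀ z → isEither (cl c) (cl c′) z ≡ true → isClique z ≡ true
    clique-only (cl _) _ = refl

  final-≈-clique-vertex : ∀ c a → S ≈[ isEither (cl c) (iv a) ] step D initial a
  final-≈-clique-vertex c a = ≈-finer clique-or-a (final-≈-alone a)
    where
    clique-or-a : ∀ z → isEither (cl c) (iv a) z ≡ true → cliqueAnd a z ≡ true
    clique-or-a (cl _) _   = refl
    clique-or-a (iv _) z≡a = z≡a

  restrict-reverse-filterᵇ : ∀ x y (p : Letter t → Bool) u →
    restrict x y (reverse (filterᵇ p u)) ≡ reverse (filterᵇ p (restrict x y u))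
  restrict-reverse-filterᵇ x y p u =
    trans (filterᵇ-reverse _ (filterᵇ p u)) (cong reverse (filterᵇ-comm _ p u))

  restrict-word : ∀ x y → restrict x y w ≡
    restrict x y (p₁ S) ++ reverse (filterᵇ (isB D) (restrict x y (p₁ S))) ++
    restrict x y (p₂ S) ++ restrict x y p₃
  restrict-word x y = begin
    R (p₁ S ++ reverse (B (p₁ S)) ++ p₂ S ++ p₃)
      ≡⟨ filterᵇ-++ _ (p₁ S) _ ⟩
    R (p₁ S) ++ R (reverse (B (p₁ S)) ++ p₂ S ++ p₃)
      ≡⟨ cong (R (p₁ S) ++_) (filterᵇ-++ _ (reverse (B (p₁ S))) _) ⟩
    R (p₁ S) ++ R (reverse (B (p₁ S))) ++ R (p₂ S ++ p₃)
      ≡⟨ cong₂ (λ u v → R (p₁ S) ++ u ++ v) (restrict-reverse-filterᵇ x y (isB D) (p₁ S)) (filterᵇ-++ _ (p₂ S) p₃) ⟩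
    R (p₁ S) ++ reverse (B (R (p₁ S))) ++ R (p₂ S) ++ R p₃
      ∎
    where
    open ≡-Reasoning
    R B : List (Letter t) → List (Letter t)
    R = restrict x y
    B = filterᵇ (isB D)

  restrict-word-≡ : ∀ {x y R₁ R₂ R₃} →
                    restrict x y (p₁ S) ≡ R₁ → restrict x y (p₂ S) ≡ R₂ → restrict x y p₃ ≡ R₃ →
                    restrict x y w ≡ R₁ ++ reverse (filterᵇ (isB D) R₁) ++ R₂ ++ R₃
  restrict-word-≡ {x} {y} refl refl refl = restrict-word x y

  d-bounds : 1 ≤ k → 1 ≤ d S × d S ≤ k
  d-bounds 1≤k = d-invariant (λ x → 1 ≤ x × x ≤ k) bounded initial (allFin t) (≤-refl , 1≤k)
    where
    bounded : ∀ {b m n x} → D b ≡ cyc m n → 1 ≤ x × x ≤ k → 1 ≤ x ⊔ m × x ⊔ m ≤ k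
    bounded {b} {m} Db (1≤x , x≤k) with wf-b ← subst (WF k) Db (wf b) =
      m≤n⇒m≤n⊔o m 1≤x , ⊔-lub x≤k (<⇒≤ (<-≤-trans (cyc-m<n wf-b) (cyc-n≤k wf-b)))

  d-above : ∀ {a m n} → D a ≡ cyc m n → m ≤ d S
  d-above {a} {m} Da with xs , ys , S≡ , _ ← final-split a rewrite S≡ =
    d-invariant (m ≤_) (λ _ m≤x → m≤n⇒m≤n⊔o _ m≤x) _ ys
      (subst (m ≤_) (sym (step-d-cyc (foldl (step D) initial xs) a Da)) (m≤n⊔m _ m))

  d-below : CycCompatible D → ∀ {a m n} → D a ≡ cyc m n → d S < n
  d-below compatible {a} {m} {n} Da =
    d-invariant (_< n) (λ {b} Db x<n → ⊔-lub x<n (proj₁ (compatible a b _ _ _ _ Da Db))) initial (allFin t) 1<n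
    where
    wf-a : WF k (cyc m n)
    wf-a = subst (WF k) Da (wf a)
    1<n : 1 < n
    1<n = ≤-<-trans (proj₁ wf-a) (cyc-m<n wf-a)

  p₃-cliqueWith : 1 ≤ k → p₃ ≡ cliqueWith k (d S) (reverse (filterᵇ (isA D) (p₁ S)))
  p₃-cliqueWith 1≤k = let 1≤d , d≤k = d-bounds 1≤k in replaceBy-clique _ 1≤d d≤k

  clique-pair-restrict : ∀ {c c′} → 1 ≤ c → c < c′ → c′ ≤ k →
                         restrict (cl c) (cl c′) w ≡ altWord (cl c) (cl c′) 6
  clique-pair-restrict {c} {c′} 1≤c c<c′ c′≤k = restrict-word-≡ R₁ R₂ R₃
    where
    R : List (Letter t) → List (Letter t)
    R = restrict (cl c) (cl c′)
    1≤k : 1 ≤ k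
    1≤k = ≤-trans 1≤c (<⇒≤ (<-≤-trans c<c′ c′≤k))
    R₁ : R (p₁ S) ≡ cl c ∷ cl c′ ∷ []
    R₁ = trans (on-p₁ (final-≈-clique-pair c c′)) (restrict-clique 1≤c c<c′ c′≤k)
    R₂ : R (p₂ S) ≡ cl c ∷ cl c′ ∷ []
    R₂ = trans (on-p₂ (final-≈-clique-pair c c′)) (restrict-clique 1≤c c<c′ c′≤k)
    no-vertex : R (reverse (filterᵇ (isA D) (p₁ S))) ≡ []
    no-vertex = trans (restrict-reverse-filterᵇ _ _ (isA D) (p₁ S)) (cong (reverse ∘ filterᵇ (isA D)) R₁)
    R₃ : R p₃ ≡ cl c ∷ cl c′ ∷ []
    R₃ = begin
      R p₃                                                      ≡⟨ cong R (p₃-cliqueWith 1≤k) ⟩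
      R (cliqueWith k (d S) (reverse (filterᵇ (isA D) (p₁ S)))) ≡⟨ filterᵇ-cliqueWith-[] _ _ no-vertex
                                                                     (proj₂ (d-bounds 1≤k)) ⟩
      R (clique k)                                              ≡⟨ restrict-clique 1≤c c<c′ c′≤k ⟩
      cl c ∷ cl c′ ∷ []                                         ∎
      where open ≡-Reasoning

  module Vertex {c : ℕ} {a : Fin t} {N : Nbhd} (Da : D a ≡ N) (1≤c : 1 ≤ c) (c≤k : c ≤ k) where

    R : List (Letter t) → List (Letter t)
    R = restrict (cl c) (iv a)

    R₁-slot : R (p₁ S) ≡ R (cliqueWith k (slot₁ N) (iv a ∷ []))
    R₁-slot = trans (on-p₁ (final-≈-clique-vertex c a)) (cong R (begin
      p₁ (step D initial a)                        ≡⟨ step-p₁ initial a ⟩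
      place₁ (D a) (iv a) (clique k)               ≡⟨ place₁-clique (iv a) (wf a) ⟩
      cliqueWith k (slot₁ (D a)) (iv a ∷ [])       ≡⟨ cong (λ N → cliqueWith k (slot₁ N) (iv a ∷ [])) Da ⟩
      cliqueWith k (slot₁ N) (iv a ∷ [])           ∎))
      where open ≡-Reasoning

    R₂-slot : R (p₂ S) ≡ R (cliqueWith k (slot₂ N) (iv a ∷ []))
    R₂-slot = trans (on-p₂ (final-≈-clique-vertex c a)) (cong R (begin
      p₂ (step D initial a)                        ≡⟨ step-p₂ initial a ⟩
      place₂ (D a) (iv a) (clique k)               ≡⟨ place₂-clique (iv a) (wf a) ⟩
      cliqueWith k (slot₂ (D a)) (iv a ∷ [])       ≡⟨ cong (λ N → cliqueWith k (slot₂ N) (iv a ∷ [])) Da ⟩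
      cliqueWith k (slot₂ N) (iv a ∷ [])           ∎))
      where open ≡-Reasoning

    R₃-slot : R p₃ ≡ R (cliqueWith k (d S) (reverse (filterᵇ (isA D) (p₁ S))))
    R₃-slot = cong R (p₃-cliqueWith (≤-trans 1≤c c≤k))

    R-isA : ∀ {R₁} → R (p₁ S) ≡ R₁ → R (reverse (filterᵇ (isA D) (p₁ S))) ≡ reverse (filterᵇ (isA D) R₁)
    R-isA R₁ = trans (restrict-reverse-filterᵇ _ _ (isA D) (p₁ S)) (cong (reverse ∘ filterᵇ (isA D)) R₁)

  vertex-cyc-low : ∀ {c a m n} → D a ≡ cyc m (suc n) → 1 ≤ c → c ≤ m →
                   restrict (cl c) (iv a) w ≡ altWord (cl c) (iv a) 6
  vertex-cyc-low {c} {a} {m} {n} Da 1≤c c≤m =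
    trans (restrict-word-≡ R₁ R₂ R₃)
      (cong (λ B → cl c ∷ iv a ∷ reverse B ++ cl c ∷ iv a ∷ cl c ∷ iv a ∷ [])
        (filterᵇ-reject (isB D) [] (isB-cyc Da)))
    where
    wf-a : WF k (cyc m (suc n))
    wf-a = subst (WF k) Da (wf a)
    c≤n : c ≤ n
    c≤n = ≤-trans c≤m (≤-pred (cyc-m<n wf-a))
    open Vertex Da 1≤c (≤-trans c≤n (<⇒≤ (cyc-n≤k wf-a)))
    R₁ : R (p₁ S) ≡ cl c ∷ iv a ∷ []
    R₁ = trans R₁-slot (restrict-cliqueWith-[a]-≤ 1≤c c≤m)
    R₂ : R (p₂ S) ≡ cl c ∷ iv a ∷ []
    R₂ = trans R₂-slot (restrict-cliqueWith-[a]-≤ 1≤c c≤n)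
    R₃ : R p₃ ≡ cl c ∷ iv a ∷ []
    R₃ = trans R₃-slot (trans (restrict-cliqueWith-≤ _ 1≤c (≤-trans c≤m (d-above Da)))
           (cong (cl c ∷_) (trans (R-isA R₁) (cong reverse (filterᵇ-accept (isA D) [] (isA-cyc Da))))))

  vertex-cyc-high : CycCompatible D → ∀ {c a m n} → D a ≡ cyc m (suc n) → n < c → c ≤ k →
                    restrict (cl c) (iv a) w ≡ altWord (iv a) (cl c) 6
  vertex-cyc-high compatible {c} {a} {m} {n} Da n<c c≤k =
    trans (restrict-word-≡ R₁ R₂ R₃)
      (cong (λ B → iv a ∷ cl c ∷ reverse B ++ iv a ∷ cl c ∷ iv a ∷ cl c ∷ [])
        (filterᵇ-reject (isB D) (cl c ∷ []) (isB-cyc Da)))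
    where
    wf-a : WF k (cyc m (suc n))
    wf-a = subst (WF k) Da (wf a)
    open Vertex Da (≤-trans (s≤s z≤n) n<c) c≤k
    R₁ : R (p₁ S) ≡ iv a ∷ cl c ∷ []
    R₁ = trans R₁-slot (restrict-cliqueWith-[a]-> (≤-<-trans (≤-pred (cyc-m<n wf-a)) n<c) c≤k)
    R₂ : R (p₂ S) ≡ iv a ∷ cl c ∷ []
    R₂ = trans R₂-slot (restrict-cliqueWith-[a]-> n<c c≤k)
    R₃ : R p₃ ≡ iv a ∷ cl c ∷ []
    R₃ = trans R₃-slot (trans (restrict-cliqueWith-> _ (<-≤-trans (d-below compatible Da) n<c) c≤k)
           (cong (_++ cl c ∷ []) (trans (R-isA R₁)
             (cong reverse (filterᵇ-accept (isA D) (cl c ∷ []) (isA-cyc Da))))))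

  vertex-ivl : ∀ {c a l r} → D a ≡ ivl (suc l) r → l < c → c ≤ r →
               restrict (cl c) (iv a) w ≡ altWord (iv a) (cl c) 6
  vertex-ivl {c} {a} {l} {r} Da l<c c≤r =
    trans (restrict-word-≡ R₁ R₂ R₃)
      (cong (λ B → iv a ∷ cl c ∷ reverse B ++ cl c ∷ iv a ∷ cl c ∷ [])
        (filterᵇ-accept (isB D) (cl c ∷ []) (isB-ivl Da)))
    where
    1≤c : 1 ≤ c
    1≤c = ≤-trans (s≤s z≤n) l<c
    c≤k : c ≤ k
    c≤k = ≤-trans c≤r (proj₂ (proj₂ (subst (WF k) Da (wf a))))
    open Vertex Da 1≤c c≤k
    R₁ : R (p₁ S) ≡ iv a ∷ cl c ∷ []
    R₁ = trans R₁-slot (restrict-cliqueWith-[a]-> l<c c≤k)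
    R₂ : R (p₂ S) ≡ cl c ∷ iv a ∷ []
    R₂ = trans R₂-slot (restrict-cliqueWith-[a]-≤ 1≤c c≤r)
    no-vertex : R (reverse (filterᵇ (isA D) (p₁ S))) ≡ []
    no-vertex = trans (R-isA R₁) (cong reverse (filterᵇ-reject (isA D) (cl c ∷ []) (isA-ivl Da)))
    R₃ : R p₃ ≡ cl c ∷ []
    R₃ = begin
      R p₃                                                      ≡⟨ R₃-slot ⟩
      R (cliqueWith k (d S) (reverse (filterᵇ (isA D) (p₁ S)))) ≡⟨ filterᵇ-cliqueWith-[] _ _ no-vertex
                                                                     (proj₂ (d-bounds (≤-trans 1≤c c≤k))) ⟩
      R (clique k)                                              ≡⟨ cong R (clique-cliqueWith c≤k) ⟩
      R (cliqueWith k c [])                                     ≡⟨ restrict-cliqueWith-≤ [] 1≤c ≤-refl ⟩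
      cl c ∷ []                                                 ∎
      where open ≡-Reasoning

  clique-vertex-alternate : CycCompatible D → ∀ c a → Mem k (D a) c → Alternate (cl c) (iv a) w
  clique-vertex-alternate compatible c a c∈Na with D a in Da | wf a | c∈Na
  ... | cyc m (suc n) | _ | inj₁ (1≤c , c≤m) = alternating  w 6 (vertex-cyc-low Da 1≤c c≤m)
  ... | cyc m (suc n) | _ | inj₂ (n<c , c≤k) = alternating′ w 6 (vertex-cyc-high compatible Da n<c c≤k)
  ... | ivl (suc l) r | _ | l<c , c≤r        = alternating′ w 6 (vertex-ivl Da l<c c≤r)

  adjacent-alternate : CycCompatible D → ∀ x y → Adj k t D x y → Alternate x y w
  adjacent-alternate _ (cl i) (cl j) ((1≤i , i≤k) , (1≤j , j≤k) , i≢j) with <-cmp i j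
  ... | tri< i<j _ _ = alternating w 6 (clique-pair-restrict 1≤i i<j j≤k)
  ... | tri≈ _ i≡j _ = contradiction i≡j i≢j
  ... | tri> _ _ j<i = alternate-sym w (alternating w 6 (clique-pair-restrict 1≤j j<i i≤k))
  adjacent-alternate compatible (cl c) (iv a) c∈Na = clique-vertex-alternate compatible c a c∈Na
  adjacent-alternate compatible (iv a) (cl c) c∈Na =
    alternate-sym w (clique-vertex-alternate compatible c a c∈Na)

lemma2 : (k t : ℕ) (D : Fin t → Nbhd)
    → (∀ a → WF k (D a))
    → (∀ a → ¬ (∀ c → c ∈[ 1 , k ] → Mem k (D a) c))
    → (∀ a b m n l r → D a ≡ cyc m n → D b ≡ ivl l r → m < l ⊎ r < n)
    → (∀ a b m n m′ n′ → D a ≡ cyc m n → D b ≡ cyc m′ n′ → m′ < n × m < n′)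
    → ∀ x y → Adj k t D x y → Alternate x y (word k t D)
lemma2 k t D wf _ _ compatible = Final.adjacent-alternate k D wf compatible
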